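{- For every integer $m\ge 2$, the digraph $\Gamma_m$ has a $\{\vec{C}_m^{1},\vec{C}_{2m}^{2}\}$-factorization, i.e. its arc set can be partitioned into one spanning subdigraph that is a vertex-disjoint union of directed $m$-cycles and two spanning subdigraphs each of which is a directed $2m$-cycle.
   Context: $\Gamma_m$ is the directed Cayley graph on the group $\mathbb{Z}_2\times\mathbb{Z}_m$ with connection set $\{(0,1),(1,0),(1,1)\}$: its vertex set is $\mathbb{Z}_2\times\mathbb{Z}_m$ and $(x,y)$ is an arc iff $y-x\in\{(0,1),(1,0),(1,1)\}$. Equivalently $\Gamma_m=(\vec{C}_m\wr\overline{K}_2)\oplus mK_2^*$, where the copies of $K_2^*$ (directed 2-cycles) join $(0,i)$ and $(1,i)$ for $0\le i\le m-1$. -}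

module Defs where

open import Data.Nat using (ℕ; zero; suc; _*_)
open import Data.Nat.DivMod using (_mod_)
open import Data.Fin using (Fin; toℕ) renaming (zero to fz; suc to fs)
open import Data.Product using (Σ; ∃; ∃-syntax; _×_; _,_)
open import Data.Sum using (_⊎_)
open import Relation.Binary.PropositionalEquality using (_≡_)
open import Relation.Nullary using (¬_)
open import Function.Definitions using (Injective)

next : ∀ {k} → Fin k → Fin k
next {suc n} i = suc (toℕ i) mod suc n

flip : Fin 2 → Fin 2
flip fz = fs fz
flip (fs _) = fz

V : ℕ → Set
V m = Fin 2 × Fin m

data Gen : Set where
  g01 g10 g11 : Gen

_+g_ : ∀ {m} → V m → Gen → V m
(a , i) +g g01 = (a , next i)
(a , i) +g g10 = (flip a , i)
(a , i) +g g11 = (flip a , next i)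

-- Arcs of the Cayley digraph Γ_m : (u , v) is an arc iff v - u ∈ connection set
Arc : (m : ℕ) → V m → V m → Set
Arc m u v = Σ Gen λ s → v ≡ u +g s

-- A subdigraph of Γ_m on the full vertex set (spanning), given by its arc set
ArcSet : ℕ → Set₁
ArcSet m = V m → V m → Set

IsCycleUnion : (m k : ℕ) → ArcSet m → Set
IsCycleUnion m k F =
  Σ ℕ λ r → Σ (Fin r → Fin k → V m) λ cs →
      (∀ a → Injective _≡_ _≡_ (cs a))
    × (∀ a b i j → cs a i ≡ cs b j → a ≡ b)
    × (∀ v → ∃[ a ] ∃[ i ] cs a i ≡ v)
    × (∀ u v → F u v → ∃[ a ] ∃[ i ] (u ≡ cs a i × v ≡ cs a (next i)))
    × (∀ a i → F (cs a i) (cs a (next i)))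

IsCycle : (m k : ℕ) → ArcSet m → Set
IsCycle m k F =
  Σ (Fin k → V m) λ c →
      Injective _≡_ _≡_ c
    × (∀ v → ∃[ i ] c i ≡ v)
    × (∀ u v → F u v → ∃[ i ] (u ≡ c i × v ≡ c (next i)))
    × (∀ i → F (c i) (c (next i)))

IsArcPartition : (m : ℕ) → ArcSet m → ArcSet m → ArcSet m → Set
IsArcPartition m F₁ F₂ F₃ =
    (∀ u v → F₁ u v → Arc m u v)
  × (∀ u v → F₂ u v → Arc m u v)
  × (∀ u v → F₃ u v → Arc m u v)
  × (∀ u v → Arc m u v → F₁ u v ⊎ F₂ u v ⊎ F₃ u v)
  × (∀ u v → ¬ (F₁ u v × F₂ u v))
  × (∀ u v → ¬ (F₁ u v × F₃ u v))
  × (∀ u v → ¬ (F₂ u v × F₃ u v))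

HasFactorization : ℕ → Set₁
HasFactorization m =
  Σ (ArcSet m) λ F₁ → Σ (ArcSet m) λ F₂ → Σ (ArcSet m) λ F₃ →
      IsArcPartition m F₁ F₂ F₃
    × IsCycleUnion m m F₁
    × IsCycle m (2 * m) F₂
    × IsCycle m (2 * m) F₃

-- The (0,1)-arcs form one cycle (a,0) → (a,1) → … on each layer a.  Of the remaining arcs,
-- taking (1,0) out of layer 0 and (1,1) out of layer 1 gives the zigzag
-- (0,0) → (1,0) → (0,1) → (1,1) → … through all 2m vertices; the other arcs form the same zigzag
-- conjugated by the layer swap (a,i) ↦ (a+1,i).  For m ≥ 2 the two zigzags are arc-disjoint
-- because i + 1 ≠ i in ℤ_m.
module Submission where

open import Defs
open import Data.Nat using (ℕ; zero; suc; _+_; _*_; _%_; _/_; _≤_; _<_; NonZero)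
open import Data.Nat.Properties
open import Data.Nat.DivMod using (_mod_; m≡m%n+[m/n]*n; [m+kn]%n≡m%n; m<n⇒m%n≡m; n%n≡0; m%n<n)
open import Data.Nat.GeneralisedArithmetic using (fold; fold-+)
open import Data.Fin using (Fin; toℕ; fromℕ<) renaming (zero to fz; suc to fs)
open import Data.Fin.Properties using (toℕ-injective; toℕ-fromℕ<; toℕ<n)
open import Data.Product using (∃-syntax; _×_; _,_; proj₁; proj₂)
open import Data.Sum using (_⊎_; inj₁; inj₂)
open import Function.Base using (_∘_)
open import Function.Definitions using (Injective)
open import Relation.Binary.PropositionalEquality
open import Relation.Nullary using (¬_)

fold-*-period : ∀ {A : Set} (a : A) (s : A → A) N → fold a s N ≡ a → ∀ q → fold a s (q * N) ≡ a
fold-*-period a s N period zero = refl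
fold-*-period a s N period (suc q) = begin
  fold a s (N + q * N)          ≡⟨ fold-+ a s N ⟩
  fold (fold a s (q * N)) s N   ≡⟨ cong (λ b → fold b s N) (fold-*-period a s N period q) ⟩
  fold a s N                    ≡⟨ period ⟩
  a                             ∎
  where open ≡-Reasoning

fold-%-period : ∀ {A : Set} (a : A) (s : A → A) N .{{_ : NonZero N}} →
                fold a s N ≡ a → ∀ x → fold a s (x % N) ≡ fold a s x
fold-%-period a s N period x = begin
  fold a s (x % N)                           ≡⟨ cong (λ b → fold b s (x % N)) (fold-*-period a s N period (x / N)) ⟨
  fold (fold a s (x / N * N)) s (x % N)      ≡⟨ fold-+ a s (x % N) ⟨
  fold a s (x % N + x / N * N)               ≡⟨ cong (fold a s) (m≡m%n+[m/n]*n x N) ⟨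
  fold a s x                                 ∎
  where open ≡-Reasoning

even-or-odd : ∀ x → ∃[ j ] (x ≡ 2 * j ⊎ x ≡ suc (2 * j))
even-or-odd zero = 0 , inj₁ refl
even-or-odd (suc x) with even-or-odd x
... | j , inj₁ refl = j , inj₂ refl
... | j , inj₂ refl = suc j , inj₁ (sym (*-suc 2 j))

module _ {n : ℕ} where

  private
    m : ℕ
    m = suc n

  toℕ-mod : ∀ j → toℕ (j mod m) ≡ j % m
  toℕ-mod j = toℕ-fromℕ< (m%n<n j m)

  toℕ-next : (i : Fin m) → toℕ (next i) ≡ suc (toℕ i) % m
  toℕ-next i = toℕ-mod (suc (toℕ i))

  mod-toℕ : (i : Fin m) → toℕ i mod m ≡ i
  mod-toℕ i = toℕ-injective (trans (toℕ-mod (toℕ i)) (m<n⇒m%n≡m (toℕ<n i)))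

  next-mod : ∀ j → next (j mod m) ≡ suc j mod m
  next-mod j = toℕ-injective (begin
    toℕ (next (j mod m))             ≡⟨ toℕ-next (j mod m) ⟩
    suc (toℕ (j mod m)) % m          ≡⟨ cong (λ r → suc r % m) (toℕ-mod j) ⟩
    suc (j % m) % m                  ≡⟨ [m+kn]%n≡m%n (suc (j % m)) (j / m) m ⟨
    suc (j % m + j / m * m) % m      ≡⟨ cong (λ x → suc x % m) (m≡m%n+[m/n]*n j m) ⟨
    suc j % m                        ≡⟨ toℕ-mod (suc j) ⟨
    toℕ (suc j mod m)                ∎)
    where open ≡-Reasoning

  next[i]≢i : 2 ≤ m → (i : Fin m) → next i ≢ i
  next[i]≢i 2≤m i next≡i with m≤n⇒m<n∨m≡n (toℕ<n i)
  ... | inj₁ 1+i<m = 1+n≢n (begin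
    suc (toℕ i)        ≡⟨ m<n⇒m%n≡m 1+i<m ⟨
    suc (toℕ i) % m    ≡⟨ toℕ-next i ⟨
    toℕ (next i)       ≡⟨ cong toℕ next≡i ⟩
    toℕ i              ∎)
    where open ≡-Reasoning
  ... | inj₂ 1+i≡m = <⇒≢ 2≤m (begin
    1                  ≡⟨ cong suc i≡0 ⟨
    suc (toℕ i)        ≡⟨ 1+i≡m ⟩
    m                  ∎)
    where
    open ≡-Reasoning
    i≡0 : toℕ i ≡ 0
    i≡0 = begin
      toℕ i            ≡⟨ cong toℕ next≡i ⟨
      toℕ (next i)     ≡⟨ toℕ-next i ⟩
      suc (toℕ i) % m  ≡⟨ cong (_% m) 1+i≡m ⟩
      m % m            ≡⟨ n%n≡0 m ⟩
      0                ∎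

Graph : ∀ {m} → (V m → V m) → ArcSet m
Graph s u v = v ≡ s u

isCycle-graph : ∀ {m k} (s : V m → V m) (c : Fin k → V m) → Injective _≡_ _≡_ c →
                (∀ v → ∃[ i ] c i ≡ v) → (∀ i → c (next i) ≡ s (c i)) → IsCycle m k (Graph s)
isCycle-graph s c injective surjective step = c , injective , surjective , exact , step
  where
  exact : ∀ u v → Graph s u v → ∃[ i ] (u ≡ c i × v ≡ c (next i))
  exact u v v≡su with surjective u
  ... | i , refl = i , refl , trans v≡su (sym (step i))

isCycle-conjugate : ∀ {m k} (τ s : V m → V m) → (∀ v → τ (τ v) ≡ v) →
                    IsCycle m k (Graph s) → IsCycle m k (Graph (τ ∘ s ∘ τ))
isCycle-conjugate τ s involutive (c , injective , surjective , _ , step) =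
  isCycle-graph (τ ∘ s ∘ τ) (τ ∘ c) τc-injective τc-surjective τc-step
  where
  τc-injective : Injective _≡_ _≡_ (τ ∘ c)
  τc-injective {i} {j} e = injective (trans (sym (involutive (c i))) (trans (cong τ e) (involutive (c j))))
  τc-surjective : ∀ v → ∃[ i ] τ (c i) ≡ v
  τc-surjective v with surjective (τ v)
  ... | i , ci≡τv = i , trans (cong τ ci≡τv) (involutive v)
  τc-step : ∀ i → τ (c (next i)) ≡ τ (s (τ (τ (c i))))
  τc-step i = cong τ (trans (step i) (cong s (sym (involutive (c i)))))

horizontal-isCycleUnion : ∀ {m} → IsCycleUnion m m (Graph (_+g g01))
horizontal-isCycleUnion = 2 , _,_ , (λ a → cong proj₂) , (λ a b i j → cong proj₁) ,
  (λ v → proj₁ v , proj₂ v , refl) , (λ { (a , i) v e → a , i , refl , e }) , (λ a i → refl)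

swapLayer : ∀ {m} → V m → V m
swapLayer v = v +g g10

swapLayer-involutive : ∀ {m} (v : V m) → swapLayer (swapLayer v) ≡ v
swapLayer-involutive (fz , i) = refl
swapLayer-involutive (fs fz , i) = refl

module _ {n : ℕ} where

  private
    m : ℕ
    m = suc n

  zigzag : V m → V m
  zigzag (fz , i) = (fs fz , i)
  zigzag (fs fz , i) = (fz , next i)

  tour : ℕ → V m
  tour = fold (fz , fz) zigzag

  tour-even : ∀ j → tour (2 * j) ≡ (fz , j mod m)
  tour-even zero = refl
  tour-even (suc j) = begin
    tour (2 * suc j)               ≡⟨ cong tour (*-suc 2 j) ⟩
    zigzag (zigzag (tour (2 * j))) ≡⟨ cong (zigzag ∘ zigzag) (tour-even j) ⟩
    (fz , next (j mod m))          ≡⟨ cong (fz ,_) (next-mod j) ⟩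
    (fz , suc j mod m)             ∎
    where open ≡-Reasoning

  tour-period : tour (2 * m) ≡ tour 0
  tour-period = trans (tour-even m) (cong (fz ,_) (toℕ-injective (trans (toℕ-mod m) (n%n≡0 m))))

  position : V m → ℕ
  position (fz , i) = 2 * toℕ i
  position (fs fz , i) = suc (2 * toℕ i)

  position<2m : ∀ v → position v < 2 * m
  position<2m (fz , i) = *-monoʳ-< 2 (toℕ<n i)
  position<2m (fs fz , i) = subst (_≤ 2 * m) (*-suc 2 (toℕ i)) (*-monoʳ-≤ 2 (toℕ<n i))

  tour-position : ∀ v → tour (position v) ≡ v
  tour-position (fz , i) = trans (tour-even (toℕ i)) (cong (fz ,_) (mod-toℕ i))
  tour-position (fs fz , i) = trans (cong zigzag (tour-even (toℕ i))) (cong (fs fz ,_) (mod-toℕ i))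

  position-tour : ∀ x → x < 2 * m → position (tour x) ≡ x
  position-tour x x<2m with even-or-odd x
  ... | j , inj₁ refl rewrite tour-even j =
    cong (2 *_) (trans (toℕ-mod j) (m<n⇒m%n≡m (*-cancelˡ-< 2 j m x<2m)))
  ... | j , inj₂ refl rewrite tour-even j =
    cong (suc ∘ (2 *_)) (trans (toℕ-mod j) (m<n⇒m%n≡m (*-cancelˡ-< 2 j m (<-trans (n<1+n _) x<2m))))

  hamiltonian : Fin (2 * m) → V m
  hamiltonian k = tour (toℕ k)

  hamiltonian-injective : Injective _≡_ _≡_ hamiltonian
  hamiltonian-injective {k} {l} e = toℕ-injective (begin
    toℕ k                   ≡⟨ position-tour (toℕ k) (toℕ<n k) ⟨
    position (hamiltonian k) ≡⟨ cong position e ⟩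
    position (hamiltonian l) ≡⟨ position-tour (toℕ l) (toℕ<n l) ⟩
    toℕ l                   ∎)
    where open ≡-Reasoning

  hamiltonian-surjective : ∀ v → ∃[ k ] hamiltonian k ≡ v
  hamiltonian-surjective v =
    fromℕ< (position<2m v) , trans (cong tour (toℕ-fromℕ< (position<2m v))) (tour-position v)

  hamiltonian-next : ∀ k → hamiltonian (next k) ≡ zigzag (hamiltonian k)
  hamiltonian-next k =
    trans (cong tour (toℕ-next k)) (fold-%-period (fz , fz) zigzag (2 * m) tour-period (suc (toℕ k)))

  zigzag-isCycle : IsCycle m (2 * m) (Graph zigzag)
  zigzag-isCycle = isCycle-graph zigzag hamiltonian hamiltonian-injective hamiltonian-surjective hamiltonian-next

  antizigzag : V m → V m
  antizigzag = swapLayer ∘ zigzag ∘ swapLayer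

  arcPartition : 2 ≤ m → IsArcPartition m (Graph (_+g g01)) (Graph zigzag) (Graph antizigzag)
  arcPartition 2≤m = horizontal-arc , zigzag-arc , antizigzag-arc , cover ,
                     horizontal-zigzag , horizontal-antizigzag , zigzag-antizigzag
    where
    horizontal-arc : ∀ u v → Graph (_+g g01) u v → Arc m u v
    horizontal-arc u v e = g01 , e
    zigzag-arc : ∀ u v → Graph zigzag u v → Arc m u v
    zigzag-arc (fz , i) v e = g10 , e
    zigzag-arc (fs fz , i) v e = g11 , e
    antizigzag-arc : ∀ u v → Graph antizigzag u v → Arc m u v
    antizigzag-arc (fz , i) v e = g11 , e
    antizigzag-arc (fs fz , i) v e = g10 , e
    cover : ∀ u v → Arc m u v → Graph (_+g g01) u v ⊎ Graph zigzag u v ⊎ Graph antizigzag u v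
    cover u v (g01 , e) = inj₁ e
    cover (fz , i) v (g10 , e) = inj₂ (inj₁ e)
    cover (fs fz , i) v (g10 , e) = inj₂ (inj₂ e)
    cover (fz , i) v (g11 , e) = inj₂ (inj₂ e)
    cover (fs fz , i) v (g11 , e) = inj₂ (inj₁ e)
    horizontal-zigzag : ∀ u v → ¬ (Graph (_+g g01) u v × Graph zigzag u v)
    horizontal-zigzag (fz , i) v (refl , ())
    horizontal-zigzag (fs fz , i) v (refl , ())
    horizontal-antizigzag : ∀ u v → ¬ (Graph (_+g g01) u v × Graph antizigzag u v)
    horizontal-antizigzag (fz , i) v (refl , ())
    horizontal-antizigzag (fs fz , i) v (refl , ())
    zigzag-antizigzag : ∀ u v → ¬ (Graph zigzag u v × Graph antizigzag u v)
    zigzag-antizigzag (fz , i) v (refl , e) = next[i]≢i 2≤m i (sym (cong proj₂ e))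
    zigzag-antizigzag (fs fz , i) v (refl , e) = next[i]≢i 2≤m i (cong proj₂ e)

lemma3p4 : (m : ℕ) → 2 ≤ m → HasFactorization m
lemma3p4 zero ()
lemma3p4 (suc n) 2≤m =
  Graph (_+g g01) , Graph zigzag , Graph antizigzag ,
  arcPartition 2≤m ,
  horizontal-isCycleUnion ,
  zigzag-isCycle ,
  isCycle-conjugate swapLayer zigzag swapLayer-involutive zigzag-isCycle
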